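{- Let $k \geq 2$ and let $1 = a_1 < a_2 < \cdots < a_k$ be integers. Define $$h_0 = \sum_{1 \leq i \leq k-1} \left\lfloor \frac{a_{i+1}}{a_i} \right\rfloor, \qquad h_1 = h_0 + \left\lceil \frac{(h_0+1)\, a_{k-1}}{a_k - a_{k-1}} \right\rceil.$$ Then: (a) $N_{h_0}(a_1, \ldots, a_k) > a_k$; (b) $N_{h_0+i}(a_1, \ldots, a_k) > (i+1) a_k$ for all integers $i \geq 0$; (c) $N_h(a_1, \ldots, a_k) > (h+1) a_{k-1} - a_k$ for all $h \geq h_1$; (d) $N_{h+1}(a_1, \ldots, a_k) = N_h(a_1, \ldots, a_k) + a_k$ for all $h \geq h_1$; (e) there exists a constant $c \geq -1$ such that $h a_k - N_h(a_1, \ldots, a_k) = c$ for all $h \geq h_1$; (f) if $h \geq h_1$, then $N_h(a_1, \ldots, a_k) = h a_k - g(a_k - a_{k-1}, a_k - a_{k-2}, \ldots, a_k - a_1, a_k)$.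
   Context: For positive integers $a_1 = 1 < a_2 < \cdots < a_k$ and an integer $h \geq 1$, $N_h(a_1, \ldots, a_k)$ denotes the smallest positive integer that cannot be written as $\sum_{i=1}^k x_i a_i$ with all $x_i$ non-negative integers and $\sum_{i=1}^k x_i \leq h$. For positive integers $b_1, \ldots, b_m$ with $\gcd(b_1, \ldots, b_m) = 1$, the Frobenius number $g(b_1, \ldots, b_m)$ is the largest integer that cannot be written as a non-negative integer linear combination $\sum_{i=1}^m x_i b_i$. -}

module Defs where

open import Data.Nat using (ℕ; zero; suc; _+_; _*_; _∸_; _≤_; _<_; _/_; pred; _<ᵇ_)
open import Data.Bool using (if_then_else_)
open import Data.Integer as ℤ using (ℤ; +_)
open import Data.Product using (Σ; ∃; _×_)
open import Relation.Binary.PropositionalEquality using (_≡_)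
open import Relation.Nullary using (¬_)

sumFrom1 : (ℕ → ℕ) → ℕ → ℕ
sumFrom1 f zero    = 0
sumFrom1 f (suc n) = sumFrom1 f n + f (suc n)

-- ⌊ m / d ⌋ and ⌈ m / d ⌉ ; they agree with the usual ones whenever d ≥ 1
-- (the divisor is written as suc (pred d) only to avoid an instance argument)
floorDiv : ℕ → ℕ → ℕ
floorDiv m d = m / suc (pred d)

ceilDiv : ℕ → ℕ → ℕ
ceilDiv m d = (m + pred d) / suc (pred d)

-- a sequence a_1 , … , a_k is given as a : ℕ → ℕ; only a 1 … a k matter.
-- admissible: k ≥ 2, a_1 = 1, a_1 < a_2 < ⋯ < a_k
Admissible : ℕ → (ℕ → ℕ) → Set
Admissible k a = (2 ≤ k) × (a 1 ≡ 1) × (∀ i → 1 ≤ i → i < k → a i < a (suc i))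

RepAtMost : ℕ → (ℕ → ℕ) → ℕ → ℕ → Set
RepAtMost k a h n =
  Σ (ℕ → ℕ) λ x → (sumFrom1 x k ≤ h) × (sumFrom1 (λ i → x i * a i) k ≡ n)

IsN : ℕ → (ℕ → ℕ) → ℕ → ℕ → Set
IsN k a h m = (1 ≤ m) × (¬ RepAtMost k a h m) × (∀ n → 1 ≤ n → n < m → RepAtMost k a h n)

RepFrob : ℕ → (ℕ → ℕ) → ℤ → Set
RepFrob m b n = Σ (ℕ → ℕ) λ x → + sumFrom1 (λ i → x i * b i) m ≡ n

IsFrobenius : ℕ → (ℕ → ℕ) → ℤ → Set
IsFrobenius m b g = (¬ RepFrob m b g) × (∀ n → g ℤ.< n → RepFrob m b n)

frobGens : ℕ → (ℕ → ℕ) → ℕ → ℕ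
frobGens k a j = if j <ᵇ k then a k ∸ a (k ∸ j) else a k

h₀ : ℕ → (ℕ → ℕ) → ℕ
h₀ k a = sumFrom1 (λ i → floorDiv (a (suc i)) (a i)) (k ∸ 1)

h₁ : ℕ → (ℕ → ℕ) → ℕ
h₁ k a = h₀ k a + ceilDiv (suc (h₀ k a) * a (k ∸ 1)) (a k ∸ a (k ∸ 1))

-- Dividing greedily, every r < a_{j+1} is a sum of at most h₀(a_1,…,a_{j+1}) terms from
-- a_1,…,a_j, so h₀ + i terms reach every number up to (i+1) a_k; for h ≥ h₁ this gives
-- N_h > (h+1) a_{k-1}.  A representation of N_h + a_k by h + 1 terms would then either use a_k,
-- leaving one of N_h by h terms, or avoid a_k and be at most (h+1) a_{k-1}.  Hence
-- N_{h+1} = N_h + a_k, and h a_k - N_h is a constant g for h ≥ h₁.  Replacing every term a_i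
-- by a_k - a_i and padding with copies of a_k, m is a sum of at most H terms a_i iff H a_k - m
-- is a sum of at most H of the generators a_k - a_{k-1}, …, a_k - a_1, a_k; letting H grow
-- identifies g as their Frobenius number.
module Submission where

open import Defs
open import Data.Nat using (ℕ; suc; _+_; _*_; _∸_; _≤_; _<_)
open import Data.Integer as ℤ using (ℤ; +_; -[1+_])
open import Data.Product using (Σ; ∃; _×_)
open import Relation.Binary.PropositionalEquality using (_≡_)

open import Data.Bool using (true; false; if_then_else_)
open import Data.Nat using (zero; z≤n; s≤s; pred; _<ᵇ_; _/_; _%_)
open import Data.Nat.DivMod using (m≡m%n+[m/n]*n; m%n<n; /-monoˡ-≤; n/1≡n)
open import Data.Nat.Properties
open import Data.Nat.Tactic.RingSolver using (solve-∀)
import Data.Integer.Properties as ℤP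
import Data.Integer.Tactic.RingSolver as ℤ-Solver
open import Data.Product using (_,_; proj₁; proj₂; ∃₂)
open import Data.Sum using (_⊎_; inj₁; inj₂; [_,_]′)
open import Relation.Nullary using (¬_; Dec; contradiction)
open import Relation.Nullary.Decidable using (yes; no; map′; _×-dec_)
open import Relation.Unary using (Decidable)
open import Relation.Binary.PropositionalEquality
  using (refl; sym; trans; cong; cong₂; subst; subst₂; module ≡-Reasoning)

private
  variable
    a : ℕ → ℕ
    j h h′ m n c : ℕ

if-< : ∀ {A : Set} {x y : A} → m < n → (if m <ᵇ n then x else y) ≡ x
if-< {m = m} {n} m<n with m <ᵇ n | <⇒<ᵇ m<n
... | true | _ = refl

if-≮ : ∀ {A : Set} {x y : A} → ¬ m < n → (if m <ᵇ n then x else y) ≡ y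
if-≮ {m = m} {n} m≮n with m <ᵇ n | <ᵇ⇒< m n
... | false | _   = refl
... | true  | T⇒< = contradiction (T⇒< _) m≮n

sumFrom1-cong : ∀ n {f g : ℕ → ℕ} → (∀ i → 1 ≤ i → i ≤ n → f i ≡ g i) →
                sumFrom1 f n ≡ sumFrom1 g n
sumFrom1-cong zero    f≗g = refl
sumFrom1-cong (suc n) f≗g = cong₂ _+_
  (sumFrom1-cong n λ i 1≤i i≤n → f≗g i 1≤i (m≤n⇒m≤1+n i≤n))
  (f≗g (suc n) (s≤s z≤n) ≤-refl)

sumFrom1-mono-≤ : ∀ n {f g : ℕ → ℕ} → (∀ i → 1 ≤ i → i ≤ n → f i ≤ g i) →
                  sumFrom1 f n ≤ sumFrom1 g n
sumFrom1-mono-≤ zero    f≤g = z≤n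
sumFrom1-mono-≤ (suc n) f≤g = +-mono-≤
  (sumFrom1-mono-≤ n λ i 1≤i i≤n → f≤g i 1≤i (m≤n⇒m≤1+n i≤n))
  (f≤g (suc n) (s≤s z≤n) ≤-refl)

sumFrom1-zero : ∀ n → sumFrom1 (λ _ → 0) n ≡ 0
sumFrom1-zero zero    = refl
sumFrom1-zero (suc n) = trans (+-identityʳ _) (sumFrom1-zero n)

sumFrom1-*ʳ : ∀ n (f : ℕ → ℕ) c → sumFrom1 (λ i → f i * c) n ≡ sumFrom1 f n * c
sumFrom1-*ʳ zero    f c = refl
sumFrom1-*ʳ (suc n) f c = trans (cong (_+ f (suc n) * c) (sumFrom1-*ʳ n f c))
                                (sym (*-distribʳ-+ c (sumFrom1 f n) (f (suc n))))

sumFrom1-head : ∀ n (f : ℕ → ℕ) → sumFrom1 f (suc n) ≡ f 1 + sumFrom1 (λ i → f (suc i)) n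
sumFrom1-head zero    f = +-comm 0 (f 1)
sumFrom1-head (suc n) f = trans (cong (_+ f (suc (suc n))) (sumFrom1-head n f)) (+-assoc (f 1) _ _)

sumFrom1-≥-head : ∀ {f : ℕ → ℕ} → 1 ≤ n → f 1 ≤ sumFrom1 f n
sumFrom1-≥-head {suc n} {f} _ = ≤-trans (m≤m+n (f 1) _) (≤-reflexive (sym (sumFrom1-head n f)))

sumFrom1-reverse : ∀ n (f : ℕ → ℕ) → sumFrom1 (λ i → f (suc n ∸ i)) n ≡ sumFrom1 f n
sumFrom1-reverse zero    f = refl
sumFrom1-reverse (suc n) f = begin
  sumFrom1 (λ i → f (suc (suc n) ∸ i)) n + f (suc (suc n) ∸ suc n)
    ≡⟨ cong₂ _+_ (sumFrom1-cong n λ i _ i≤n → cong f (+-∸-assoc 1 (m≤n⇒m≤1+n i≤n)))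
                 (cong f (m+n∸n≡m 1 n)) ⟩
  sumFrom1 (λ i → f (suc (suc n ∸ i))) n + f 1
    ≡⟨ cong (_+ f 1) (sumFrom1-reverse n (λ i → f (suc i))) ⟩
  sumFrom1 (λ i → f (suc i)) n + f 1
    ≡⟨ +-comm _ (f 1) ⟩
  f 1 + sumFrom1 (λ i → f (suc i)) n
    ≡⟨ sumFrom1-head n f ⟨
  sumFrom1 f (suc n) ∎
  where open ≡-Reasoning

sumFrom1-complement : ∀ n (x : ℕ → ℕ) {c d : ℕ → ℕ} {e} →
  (∀ i → 1 ≤ i → i ≤ n → c i + d i ≡ e) →
  sumFrom1 (λ i → x i * c i) n + sumFrom1 (λ i → x i * d i) n ≡ sumFrom1 x n * e
sumFrom1-complement zero    x c+d≡e = refl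
sumFrom1-complement (suc n) x {c} {d} {e} c+d≡e = begin
  (P + xₙ * c (suc n)) + (Q + xₙ * d (suc n))
    ≡⟨ regroup P Q xₙ (c (suc n)) (d (suc n)) ⟩
  (P + Q) + xₙ * (c (suc n) + d (suc n))
    ≡⟨ cong₂ (λ u v → u + xₙ * v)
             (sumFrom1-complement n x λ i 1≤i i≤n → c+d≡e i 1≤i (m≤n⇒m≤1+n i≤n))
             (c+d≡e (suc n) (s≤s z≤n) ≤-refl) ⟩
  sumFrom1 x n * e + xₙ * e
    ≡⟨ *-distribʳ-+ e (sumFrom1 x n) xₙ ⟨
  sumFrom1 x (suc n) * e ∎
  where
  open ≡-Reasoning
  P = sumFrom1 (λ i → x i * c i) n
  Q = sumFrom1 (λ i → x i * d i) n
  xₙ = x (suc n)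
  regroup : ∀ P Q x c d → (P + x * c) + (Q + x * d) ≡ (P + Q) + x * (c + d)
  regroup = solve-∀

extend : ℕ → (ℕ → ℕ) → ℕ → ℕ → ℕ
extend j x v i = if j <ᵇ i then v else x i

RepAtMost-zero : ∀ j → RepAtMost j a h 0
RepAtMost-zero j = (λ _ → 0) , ≤-trans (≤-reflexive (sumFrom1-zero j)) z≤n , sumFrom1-zero j

RepAtMost-mono : h ≤ h′ → RepAtMost j a h n → RepAtMost j a h′ n
RepAtMost-mono h≤h′ (x , count≤h , value) = x , ≤-trans count≤h h≤h′ , value

RepAtMost-extend : ∀ j v → RepAtMost j a h n → RepAtMost (suc j) a (h + v) (n + v * a (suc j))
RepAtMost-extend {a = a} {h = h} j v (x , count≤h , refl) =
  extend j x v ,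
  subst (_≤ h + v) (sym (cong₂ _+_ (sumFrom1-cong j x′≗x) x′ⱼ₊₁≡v)) (+-monoˡ-≤ v count≤h) ,
  cong₂ _+_ (sumFrom1-cong j λ i 1≤i i≤j → cong (_* a i) (x′≗x i 1≤i i≤j))
            (cong (_* a (suc j)) x′ⱼ₊₁≡v)
  where
  x′≗x : ∀ i → 1 ≤ i → i ≤ j → extend j x v i ≡ x i
  x′≗x i _ i≤j = if-≮ (≤⇒≯ i≤j)
  x′ⱼ₊₁≡v : extend j x v (suc j) ≡ v
  x′ⱼ₊₁≡v = if-< {m = j} ≤-refl

RepAtMost-last : RepAtMost (suc j) a h n →
  ∃₂ λ v h′ → ∃ λ n′ → RepAtMost j a h′ n′ × h′ + v ≤ h × n′ + v * a (suc j) ≡ n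
RepAtMost-last {j = j} (x , count≤h , value) =
  x (suc j) , sumFrom1 x j , _ , (x , ≤-refl , refl) , count≤h , value

RepAtMost-addLast : RepAtMost (suc j) a h n → RepAtMost (suc j) a (suc h) (n + a (suc j))
RepAtMost-addLast {j = j} {a = a} {h = h} rep with RepAtMost-last rep
... | v , h′ , n′ , rep′ , h′+v≤h , refl =
  RepAtMost-mono (subst (_≤ suc h) (sym (+-suc h′ v)) (s≤s h′+v≤h))
    (subst (RepAtMost (suc j) a (h′ + suc v)) (regroup n′ v (a (suc j)))
           (RepAtMost-extend j (suc v) rep′))
  where
  regroup : ∀ n v c → n + suc v * c ≡ n + v * c + c
  regroup = solve-∀

RepAtMost? : ∀ (a : ℕ → ℕ) j h n → Dec (RepAtMost j a h n)
RepAtMost? a zero    h n =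
  map′ (λ { refl → RepAtMost-zero {a = a} {h = h} 0 }) (λ { (_ , _ , value) → sym value }) (n ≟ 0)
RepAtMost? a (suc j) h n = map′ fromLast toLast (anyUpTo? lastCoins? (suc h))
  where
  LastCoins : ℕ → Set
  LastCoins v = v * a (suc j) ≤ n × RepAtMost j a (h ∸ v) (n ∸ v * a (suc j))
  lastCoins? : Decidable LastCoins
  lastCoins? v = (v * a (suc j) ≤? n) ×-dec RepAtMost? a j (h ∸ v) (n ∸ v * a (suc j))
  fromLast : (∃ λ v → v < suc h × LastCoins v) → RepAtMost (suc j) a h n
  fromLast (v , v<1+h , va≤n , rep) =
    subst₂ (RepAtMost (suc j) a) (m∸n+n≡m (m<1+n⇒m≤n v<1+h)) (m∸n+n≡m va≤n)
      (RepAtMost-extend j v rep)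
  toLast : RepAtMost (suc j) a h n → ∃ λ v → v < suc h × LastCoins v
  toLast rep with RepAtMost-last rep
  ... | v , h′ , n′ , rep′ , h′+v≤h , refl =
    v , s≤s (m+n≤o⇒n≤o h′ h′+v≤h) , m≤n+m _ n′ ,
    RepAtMost-mono {j = j} {a = a} (m+n≤o⇒m≤o∸n h′ h′+v≤h)
      (subst (RepAtMost j a h′) (sym (m+n∸n≡m n′ (v * a (suc j)))) rep′)

RepAtMost-≤ : (∀ i → 1 ≤ i → i ≤ j → a i ≤ c) → RepAtMost j a h n → n ≤ h * c
RepAtMost-≤ {j = j} {a = a} {c = c} {h = h} aᵢ≤c (x , count≤h , refl) = begin
  sumFrom1 (λ i → x i * a i) j
    ≤⟨ sumFrom1-mono-≤ j (λ i 1≤i i≤j → *-monoʳ-≤ (x i) (aᵢ≤c i 1≤i i≤j)) ⟩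
  sumFrom1 (λ i → x i * c) j
    ≡⟨ sumFrom1-*ʳ j x c ⟩
  sumFrom1 x j * c
    ≤⟨ *-monoˡ-≤ c count≤h ⟩
  h * c ∎
  where open ≤-Reasoning

divMod-≤floorDiv : ∀ {d} r N → 1 ≤ d → r ≤ N →
  ∃₂ λ q ρ → ρ < d × q ≤ floorDiv N d × ρ + q * d ≡ r
divMod-≤floorDiv {suc d} r N _ r≤N =
  r / suc d , r % suc d , m%n<n r (suc d) , /-monoˡ-≤ (suc d) r≤N ,
  sym (m≡m%n+[m/n]*n r (suc d))

ceilDiv-≤⇒≤* : ∀ {d} X i → 1 ≤ d → ceilDiv X d ≤ i → X ≤ i * d
ceilDiv-≤⇒≤* {suc d} X i _ ⌈X/d⌉≤i = +-cancelʳ-≤ d X (i * suc d) (begin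
  X + d                                       ≡⟨ m≡m%n+[m/n]*n (X + d) (suc d) ⟩
  (X + d) % suc d + (X + d) / suc d * suc d   ≤⟨ +-mono-≤ (m<1+n⇒m≤n (m%n<n (X + d) (suc d)))
                                                         (*-monoˡ-≤ (suc d) ⌈X/d⌉≤i) ⟩
  d + i * suc d                               ≡⟨ +-comm d _ ⟩
  i * suc d + d                               ∎)
  where open ≤-Reasoning

greedy-RepAtMost : a 1 ≡ 1 → (∀ i → 1 ≤ i → i ≤ j → 1 ≤ a i) →
                   ∀ r → r < a (suc j) → RepAtMost j a (h₀ (suc j) a) r
greedy-RepAtMost {a = a} {j = zero} a₁≡1 _ r r<a₁ =
  subst (RepAtMost 0 a 0) (sym (n<1⇒n≡0 (subst (r <_) a₁≡1 r<a₁)))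
    (RepAtMost-zero {a = a} {h = 0} 0)
greedy-RepAtMost {a = a} {j = suc j} a₁≡1 aᵢ≥1 r r<aⱼ₊₂
  with divMod-≤floorDiv r (a (suc (suc j))) (aᵢ≥1 (suc j) (s≤s z≤n) ≤-refl) (<⇒≤ r<aⱼ₊₂)
... | q , ρ , ρ<aⱼ₊₁ , q≤ , refl =
  RepAtMost-mono (+-monoʳ-≤ (h₀ (suc j) a) q≤)
    (RepAtMost-extend j q
      (greedy-RepAtMost a₁≡1 (λ i 1≤i i≤j → aᵢ≥1 i 1≤i (m≤n⇒m≤1+n i≤j)) ρ ρ<aⱼ₊₁))

module _ {P : ℕ → Set} (P? : Decidable P) where

  allBelow-or-firstFailure : ∀ w →
    (∀ n → n < w → P n) ⊎ (∃ λ m → ¬ P m × (∀ n → n < m → P n))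
  allBelow-or-firstFailure zero = inj₁ λ _ ()
  allBelow-or-firstFailure (suc w) with allBelow-or-firstFailure w
  ... | inj₂ failure = inj₂ failure
  ... | inj₁ below with P? w
  ...   | no ¬Pw = inj₂ (w , ¬Pw , below)
  ...   | yes Pw = inj₁ λ n n<1+w → [ below n , (λ { refl → Pw }) ]′ (m<1+n⇒m<n∨m≡n n<1+w)

  firstFailure : ∀ w → ¬ P w → ∃ λ m → ¬ P m × (∀ n → n < m → P n)
  firstFailure w ¬Pw with allBelow-or-firstFailure (suc w)
  ... | inj₁ below   = contradiction (below w ≤-refl) ¬Pw
  ... | inj₂ failure = failure

IsN⇒RepAtMost : ∀ {k a h m n} → IsN k a h m → n < m → RepAtMost k a h n
IsN⇒RepAtMost {k = k} {n = zero}  _               _   = RepAtMost-zero k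
IsN⇒RepAtMost         {n = suc n} (_ , _ , below) n<m = below (suc n) (s≤s z≤n) n<m

IsN-≤ : ∀ {k a h m n} → IsN k a h m → ¬ RepAtMost k a h n → m ≤ n
IsN-≤ {k} {a} {h} isN ¬rep = ≮⇒≥ λ n<m → ¬rep (IsN⇒RepAtMost {k} {a} {h} isN n<m)

IsN-unique : ∀ {k a h m m′} → IsN k a h m → IsN k a h m′ → m ≡ m′
IsN-unique {k} {a} {h} isN isN′ =
  ≤-antisym (IsN-≤ {k} {a} {h} isN (proj₁ (proj₂ isN′)))
            (IsN-≤ {k} {a} {h} isN′ (proj₁ (proj₂ isN)))

IsN-exists : ∀ {k a} → (∀ i → 1 ≤ i → i ≤ k → a i ≤ a k) → ∀ h → ∃ (IsN k a h)
IsN-exists {k = k} {a = a} aᵢ≤aₖ h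
  with firstFailure (RepAtMost? a k h) (suc (h * a k))
                    (λ rep → <-irrefl refl (RepAtMost-≤ aᵢ≤aₖ rep))
... | zero  , ¬rep₀ , _     = contradiction (RepAtMost-zero k) ¬rep₀
... | suc m , ¬rep  , below = suc m , s≤s z≤n , ¬rep , λ n _ n<m → below n n<m

[n+o]⊖o≡n : ∀ n o → (n + o) ℤ.⊖ o ≡ + n
[n+o]⊖o≡n n o = trans (ℤP.⊖-≥ (m≤n+m o n)) (cong +_ (m+n∸n≡m n o))

m<n+o⇒m-o<n : ∀ m n o → m < n + o → + m ℤ.- + o ℤ.< + n
m<n+o⇒m-o<n m n o m<n+o = begin-strict
  + m ℤ.- + o     ≡⟨ ℤP.[+m]-[+n]≡m⊖n m o ⟩
  m ℤ.⊖ o         <⟨ ℤP.⊖-monoˡ-< o m<n+o ⟩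
  (n + o) ℤ.⊖ o   ≡⟨ [n+o]⊖o≡n n o ⟩
  + n             ∎
  where open ℤP.≤-Reasoning

m-o<n⇒m<n+o : ∀ m n o → + m ℤ.- + o ℤ.< + n → m < n + o
m-o<n⇒m<n+o m n o m-o<n = ≰⇒> λ n+o≤m → ℤP.<⇒≱ m-o<n (begin
  + n             ≡⟨ [n+o]⊖o≡n n o ⟨
  (n + o) ℤ.⊖ o   ≤⟨ ℤP.⊖-monoˡ-≤ o n+o≤m ⟩
  m ℤ.⊖ o         ≡⟨ ℤP.[+m]-[+n]≡m⊖n m o ⟨
  + m ℤ.- + o     ∎)
  where open ℤP.≤-Reasoning

n≤1+m⇒-1≤m-n : ∀ m n → n ≤ suc m → -[1+ 0 ] ℤ.≤ + m ℤ.- + n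
n≤1+m⇒-1≤m-n m n n≤1+m = begin
  -[1+ 0 ]           ≡⟨ cong (λ d → ℤ.- (+ d)) (m+n∸n≡m 1 m) ⟨
  ℤ.- + (suc m ∸ m)  ≡⟨ ℤP.⊖-< (n<1+n m) ⟨
  m ℤ.⊖ suc m        ≤⟨ ℤP.⊖-monoʳ-≥-≤ m n≤1+m ⟩
  m ℤ.⊖ n            ≡⟨ ℤP.[+m]-[+n]≡m⊖n m n ⟨
  + m ℤ.- + n        ∎
  where open ℤP.≤-Reasoning

m+y≡n+x⇒x-m≡y-n : ∀ {m n x y} → m + y ≡ n + x → + x ℤ.- + m ≡ + y ℤ.- + n
m+y≡n+x⇒x-m≡y-n {m} {n} {x} {y} m+y≡n+x = begin
  + x ℤ.- + m              ≡⟨ ℤP.[+m]-[+n]≡m⊖n x m ⟩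
  x ℤ.⊖ m                  ≡⟨ ℤP.+-cancelˡ-⊖ n x m ⟨
  (n + x) ℤ.⊖ (n + m)      ≡⟨ cong₂ ℤ._⊖_ (sym m+y≡n+x) (+-comm n m) ⟩
  (m + y) ℤ.⊖ (m + n)      ≡⟨ ℤP.+-cancelˡ-⊖ m y n ⟩
  y ℤ.⊖ n                  ≡⟨ ℤP.[+m]-[+n]≡m⊖n y n ⟨
  + y ℤ.- + n              ∎
  where open ≡-Reasoning

x-m≡c⇒c+m≡x : ∀ {m x c} → + x ℤ.- + m ≡ + c → c + m ≡ x
x-m≡c⇒c+m≡x {m} {x} {c} x-m≡c = ℤP.+-injective (begin
  + (c + m)               ≡⟨ ℤP.pos-+ c m ⟩
  + c ℤ.+ + m             ≡⟨ cong (ℤ._+ + m) x-m≡c ⟨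
  (+ x ℤ.- + m) ℤ.+ + m   ≡⟨ i-j+j≡i (+ x) (+ m) ⟩
  + x                     ∎)
  where
  open ≡-Reasoning
  i-j+j≡i : ∀ i j → (i ℤ.- j) ℤ.+ j ≡ i
  i-j+j≡i = ℤ-Solver.solve-∀

x-m≡g⇒m≡x-g : ∀ {m x g} → + x ℤ.- + m ≡ g → + m ≡ + x ℤ.- g
x-m≡g⇒m≡x-g {m} {x} refl = i≡j-[j-i] (+ m) (+ x)
  where
  i≡j-[j-i] : ∀ i j → i ≡ j ℤ.- (j ℤ.- i)
  i≡j-[j-i] = ℤ-Solver.solve-∀

module Complement {K : ℕ} {a : ℕ → ℕ} (aᵢ≤aₖ : ∀ i → 1 ≤ i → i ≤ K → a i ≤ a (suc K)) where

  private
    k : ℕ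
    k = suc K

    b : ℕ → ℕ
    b = frobGens k a

  mirror : ℕ → (ℕ → ℕ) → ℕ → ℕ
  mirror t x j = if j <ᵇ k then x (k ∸ j) else t

  sumFrom1-mirror : ∀ (f : ℕ → ℕ → ℕ) t x →
    sumFrom1 (λ j → f (mirror t x j) j) k ≡ sumFrom1 (λ i → f (x i) (k ∸ i)) K + f t k
  sumFrom1-mirror f t x = cong₂ _+_ (begin
      sumFrom1 (λ j → f (mirror t x j) j) K
        ≡⟨ sumFrom1-cong K (λ j _ j≤K →
             cong₂ f (if-< (s≤s j≤K)) (sym (m∸[m∸n]≡n (m≤n⇒m≤1+n j≤K)))) ⟩
      sumFrom1 (λ j → f (x (k ∸ j)) (k ∸ (k ∸ j))) K
        ≡⟨ sumFrom1-reverse K (λ i → f (x i) (k ∸ i)) ⟩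
      sumFrom1 (λ i → f (x i) (k ∸ i)) K ∎)
    (cong (λ v → f v k) (if-≮ {m = k} (<-irrefl refl)))
    where open ≡-Reasoning

  frobGens-last : b k ≡ a k
  frobGens-last = if-≮ {m = k} (<-irrefl refl)

  frobGens+a≡aₖ : ∀ j → 1 ≤ j → j ≤ K → b j + a (k ∸ j) ≡ a k
  frobGens+a≡aₖ j 1≤j j≤K = trans (cong (_+ a (k ∸ j)) (if-< (s≤s j≤K)))
    (m∸n+n≡m (aᵢ≤aₖ (k ∸ j) (m<n⇒0<n∸m (s≤s j≤K)) (∸-monoʳ-≤ k 1≤j)))

  frobGens-mirror+a≡aₖ : ∀ i → 1 ≤ i → i ≤ K → b (k ∸ i) + a i ≡ a k
  frobGens-mirror+a≡aₖ i 1≤i i≤K =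
    subst (λ l → b (k ∸ i) + a l ≡ a k) (m∸[m∸n]≡n (m≤n⇒m≤1+n i≤K))
      (frobGens+a≡aₖ (k ∸ i) (m<n⇒0<n∸m (s≤s i≤K)) (∸-monoʳ-≤ k 1≤i))

  sumFrom1-complement-+ : ∀ (x c d : ℕ → ℕ) t s → (∀ i → 1 ≤ i → i ≤ K → c i + d i ≡ a k) →
    (sumFrom1 (λ i → x i * c i) K + t * a k) + (sumFrom1 (λ i → x i * d i) K + s * a k) ≡
    (sumFrom1 x K + s + t) * a k
  sumFrom1-complement-+ x c d t s c+d≡aₖ = begin
    (P + t * a k) + (Q + s * a k)       ≡⟨ shuffle P Q t s (a k) ⟩
    (P + Q) + (s + t) * a k
      ≡⟨ cong (_+ (s + t) * a k) (sumFrom1-complement K x c+d≡aₖ) ⟩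
    sumFrom1 x K * a k + (s + t) * a k  ≡⟨ collect (sumFrom1 x K) s t (a k) ⟩
    (sumFrom1 x K + s + t) * a k        ∎
    where
    open ≡-Reasoning
    P = sumFrom1 (λ i → x i * c i) K
    Q = sumFrom1 (λ i → x i * d i) K
    shuffle : ∀ P Q t s c → (P + t * c) + (Q + s * c) ≡ (P + Q) + (s + t) * c
    shuffle = solve-∀
    collect : ∀ S s t c → S * c + (s + t) * c ≡ (S + s + t) * c
    collect = solve-∀

  RepAtMost⇒complement : RepAtMost k a h m →
    ∃ λ (y : ℕ → ℕ) → sumFrom1 (λ j → y j * b j) k + m ≡ h * a k
  RepAtMost⇒complement {h = h} (x , count≤h , refl) = mirror t x , (begin
      sumFrom1 (λ j → mirror t x j * b j) k + sumFrom1 (λ i → x i * a i) k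
        ≡⟨ cong (_+ sumFrom1 (λ i → x i * a i) k)
             (trans (sumFrom1-mirror (λ v j → v * b j) t x)
                    (cong (λ c → sumFrom1 (λ i → x i * b (k ∸ i)) K + t * c) frobGens-last)) ⟩
      (sumFrom1 (λ i → x i * b (k ∸ i)) K + t * a k) + (sumFrom1 (λ i → x i * a i) K + x k * a k)
        ≡⟨ sumFrom1-complement-+ x (λ i → b (k ∸ i)) a t (x k) frobGens-mirror+a≡aₖ ⟩
      (sumFrom1 x k + t) * a k
        ≡⟨ cong (_* a k) (m+[n∸m]≡n count≤h) ⟩
      h * a k ∎)
    where
    open ≡-Reasoning
    t = h ∸ sumFrom1 x k

  complement⇒RepAtMost : ∀ y → sumFrom1 (λ j → y j * b j) k + m ≡ h * a k →
                         sumFrom1 y k ≤ h → RepAtMost k a h m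
  complement⇒RepAtMost {m = m} {h = h} y Σb+m≡h*aₖ count≤h = mirror t y , count≤h′ , value≡m
    where
    t = h ∸ sumFrom1 y k
    Σb = sumFrom1 (λ j → y j * b j) k

    count≤h′ : sumFrom1 (mirror t y) k ≤ h
    count≤h′ = begin
      sumFrom1 (mirror t y) k  ≡⟨ sumFrom1-mirror (λ v _ → v) t y ⟩
      sumFrom1 y K + t         ≤⟨ +-monoˡ-≤ t (m≤m+n _ (y k)) ⟩
      sumFrom1 y k + t         ≡⟨ m+[n∸m]≡n count≤h ⟩
      h                        ∎
      where open ≤-Reasoning

    value≡m : sumFrom1 (λ i → mirror t y i * a i) k ≡ m
    value≡m = +-cancelʳ-≡ Σb _ _ (begin
      sumFrom1 (λ i → mirror t y i * a i) k + Σb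
        ≡⟨ cong₂ (λ u c → u + (sumFrom1 (λ j → y j * b j) K + y k * c))
                 (sumFrom1-mirror (λ v i → v * a i) t y) frobGens-last ⟩
      (sumFrom1 (λ i → y i * a (k ∸ i)) K + t * a k) + (sumFrom1 (λ j → y j * b j) K + y k * a k)
        ≡⟨ sumFrom1-complement-+ y (λ i → a (k ∸ i)) b t (y k)
             (λ i 1≤i i≤K → trans (+-comm (a (k ∸ i)) (b i)) (frobGens+a≡aₖ i 1≤i i≤K)) ⟩
      (sumFrom1 y k + t) * a k  ≡⟨ cong (_* a k) (m+[n∸m]≡n count≤h) ⟩
      h * a k                   ≡⟨ Σb+m≡h*aₖ ⟨
      Σb + m                    ≡⟨ +-comm Σb m ⟩
      m + Σb                    ∎)
      where open ≡-Reasoning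

module AdmissibleSequence {K : ℕ} {a : ℕ → ℕ} (admissible : Admissible (suc K) a) where

  private
    k : ℕ
    k = suc K

    1≤K : 1 ≤ K
    1≤K = ≤-pred (proj₁ admissible)

    a₁≡1 : a 1 ≡ 1
    a₁≡1 = proj₁ (proj₂ admissible)

    increasing : ∀ i → 1 ≤ i → i < k → a i < a (suc i)
    increasing = proj₂ (proj₂ admissible)

  a-mono : ∀ {i j} → 1 ≤ i → i ≤ j → j ≤ k → a i ≤ a j
  a-mono {j = zero} 1≤i i≤0 _ = contradiction (≤-trans 1≤i i≤0) λ ()
  a-mono {i} {suc j} 1≤i i≤1+j 1+j≤k with m≤n⇒m<n∨m≡n i≤1+j
  ... | inj₂ refl      = ≤-refl
  ... | inj₁ (s≤s i≤j) = ≤-trans (a-mono 1≤i i≤j (<⇒≤ 1+j≤k))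
                                 (<⇒≤ (increasing j (≤-trans 1≤i i≤j) 1+j≤k))

  a-pos : ∀ i → 1 ≤ i → i ≤ k → 1 ≤ a i
  a-pos i 1≤i i≤k = subst (_≤ a i) a₁≡1 (a-mono ≤-refl 1≤i i≤k)

  aᵢ≤aₖ : ∀ i → 1 ≤ i → i ≤ k → a i ≤ a k
  aᵢ≤aₖ i 1≤i i≤k = a-mono 1≤i i≤k ≤-refl

  aₖ₋₁<aₖ : a K < a k
  aₖ₋₁<aₖ = increasing K 1≤K ≤-refl

  h₀-pos : 1 ≤ h₀ k a
  h₀-pos = ≤-trans (a-pos 2 (s≤s z≤n) (proj₁ admissible))
                   (≤-trans (≤-reflexive a₂≡⌊a₂/a₁⌋) (sumFrom1-≥-head 1≤K))
    where
    a₂≡⌊a₂/a₁⌋ : a 2 ≡ floorDiv (a 2) (a 1)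
    a₂≡⌊a₂/a₁⌋ = sym (trans (cong (λ d → a 2 / suc (pred d)) a₁≡1) (n/1≡n (a 2)))

  h₀≤h₁ : h₀ k a ≤ h₁ k a
  h₀≤h₁ = m≤m+n _ _

  N-exists : ∀ h → ∃ (IsN k a h)
  N-exists = IsN-exists aᵢ≤aₖ

  ≤[1+i]aₖ⇒RepAtMost : ∀ i m → m ≤ suc i * a k → RepAtMost k a (h₀ k a + i) m
  ≤[1+i]aₖ⇒RepAtMost zero m m≤aₖ+0 with m≤n⇒m<n∨m≡n (subst (m ≤_) (+-identityʳ (a k)) m≤aₖ+0)
  ... | inj₁ m<aₖ =
    subst (RepAtMost k a (h₀ k a + 0)) (+-identityʳ m)
      (RepAtMost-extend K 0
        (greedy-RepAtMost a₁≡1 (λ i 1≤i i≤K → a-pos i 1≤i (m≤n⇒m≤1+n i≤K)) m m<aₖ))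
  ... | inj₂ refl =
    RepAtMost-mono (≤-trans h₀-pos (m≤m+n _ 0))
      (RepAtMost-addLast (RepAtMost-zero {a = a} {h = 0} k))
  ≤[1+i]aₖ⇒RepAtMost (suc i) m m≤[2+i]aₖ with m ≤? suc i * a k
  ... | yes m≤[1+i]aₖ =
    RepAtMost-mono (+-monoʳ-≤ (h₀ k a) (n≤1+n i)) (≤[1+i]aₖ⇒RepAtMost i m m≤[1+i]aₖ)
  ... | no m≰[1+i]aₖ =
    subst₂ (RepAtMost k a) (sym (+-suc (h₀ k a) i)) (m∸n+n≡m aₖ≤m)
      (RepAtMost-addLast (≤[1+i]aₖ⇒RepAtMost i (m ∸ a k) m-aₖ≤[1+i]aₖ))
    where
    aₖ≤m : a k ≤ m
    aₖ≤m = ≤-trans (m≤m+n (a k) (i * a k)) (<⇒≤ (≰⇒> m≰[1+i]aₖ))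
    m-aₖ≤[1+i]aₖ : m ∸ a k ≤ suc i * a k
    m-aₖ≤[1+i]aₖ = subst (m ∸ a k ≤_) (m+n∸m≡n (a k) (suc i * a k)) (∸-monoˡ-≤ (a k) m≤[2+i]aₖ)

  N>[1+i]aₖ : ∀ i m → IsN k a (h₀ k a + i) m → suc i * a k < m
  N>[1+i]aₖ i m (_ , ¬rep , _) = ≰⇒> λ m≤[1+i]aₖ → ¬rep (≤[1+i]aₖ⇒RepAtMost i m m≤[1+i]aₖ)

  N>aₖ : ∀ m → IsN k a (h₀ k a) m → a k < m
  N>aₖ m isN = subst (_< m) (+-identityʳ (a k))
    (N>[1+i]aₖ 0 m (subst (λ h → IsN k a h m) (sym (+-identityʳ (h₀ k a))) isN))

  [1+h]aₖ₋₁≤[h-h₀]aₖ : h₁ k a ≤ h → suc h * a K ≤ (h ∸ h₀ k a) * a k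
  [1+h]aₖ₋₁≤[h-h₀]aₖ {h} h₁≤h = begin
    suc h * a K                   ≡⟨ cong (λ h → suc h * a K) h₀+i≡h ⟨
    (suc (h₀ k a) + i) * a K      ≡⟨ *-distribʳ-+ (a K) (suc (h₀ k a)) i ⟩
    suc (h₀ k a) * a K + i * a K  ≤⟨ +-monoˡ-≤ (i * a K) [1+h₀]aₖ₋₁≤i[aₖ-aₖ₋₁] ⟩
    i * (a k ∸ a K) + i * a K     ≡⟨ *-distribˡ-+ i (a k ∸ a K) (a K) ⟨
    i * (a k ∸ a K + a K)         ≡⟨ cong (i *_) (m∸n+n≡m (<⇒≤ aₖ₋₁<aₖ)) ⟩
    i * a k                       ∎
    where
    open ≤-Reasoning
    i = h ∸ h₀ k a
    h₀+i≡h : h₀ k a + i ≡ h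
    h₀+i≡h = m+[n∸m]≡n (≤-trans h₀≤h₁ h₁≤h)
    [1+h₀]aₖ₋₁≤i[aₖ-aₖ₋₁] : suc (h₀ k a) * a K ≤ i * (a k ∸ a K)
    [1+h₀]aₖ₋₁≤i[aₖ-aₖ₋₁] = ceilDiv-≤⇒≤* _ i (m<n⇒0<n∸m aₖ₋₁<aₖ)
      (+-cancelˡ-≤ (h₀ k a) _ _ (subst (h₁ k a ≤_) (sym h₀+i≡h) h₁≤h))

  N>[1+h]aₖ₋₁ : h₁ k a ≤ h → IsN k a h m → suc h * a K < m
  N>[1+h]aₖ₋₁ {h} {m} h₁≤h isN =
    ≤-<-trans ([1+h]aₖ₋₁≤[h-h₀]aₖ h₁≤h) (≤-<-trans (m≤n+m _ (a k)) (N>[1+i]aₖ (h ∸ h₀ k a) m isN′))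
    where
    isN′ : IsN k a (h₀ k a + (h ∸ h₀ k a)) m
    isN′ = subst (λ h → IsN k a h m) (sym (m+[n∸m]≡n (≤-trans h₀≤h₁ h₁≤h))) isN

  RepAtMost-removeLast : RepAtMost k a (suc h) (m + a k) → RepAtMost k a h m ⊎ m + a k ≤ suc h * a K
  RepAtMost-removeLast {h} {m} rep with RepAtMost-last rep
  ... | zero , h′ , n′ , rep′ , h′+0≤1+h , n′+0≡m+aₖ =
    inj₂ (subst (_≤ suc h * a K) (trans (sym (+-identityʳ n′)) n′+0≡m+aₖ)
           (RepAtMost-≤ (λ i 1≤i i≤K → a-mono 1≤i i≤K (n≤1+n K))
             (RepAtMost-mono {j = K} {a = a} (subst (_≤ suc h) (+-identityʳ h′) h′+0≤1+h) rep′)))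
  ... | suc v , h′ , n′ , rep′ , h′+1+v≤1+h , n′+[1+v]aₖ≡m+aₖ =
    inj₁ (RepAtMost-mono (≤-pred (subst (_≤ suc h) (+-suc h′ v) h′+1+v≤1+h))
           (subst (RepAtMost k a (h′ + v))
             (+-cancelʳ-≡ (a k) _ _ (trans (regroup n′ v (a k)) n′+[1+v]aₖ≡m+aₖ))
             (RepAtMost-extend K v rep′)))
    where
    regroup : ∀ n v c → n + v * c + c ≡ n + suc v * c
    regroup = solve-∀

  N-suc : h₁ k a ≤ h → IsN k a h m → IsN k a (suc h) (m + a k)
  N-suc {h} {m} h₁≤h isN@(1≤m , ¬rep , _) = ≤-trans 1≤m (m≤m+n m (a k)) , ¬rep′ , below′
    where
    ¬rep′ : ¬ RepAtMost k a (suc h) (m + a k)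
    ¬rep′ rep with RepAtMost-removeLast rep
    ... | inj₁ rep′    = ¬rep rep′
    ... | inj₂ m+aₖ≤ = <⇒≱ (N>[1+h]aₖ₋₁ h₁≤h isN) (≤-trans (m≤m+n m (a k)) m+aₖ≤)

    below′ : ∀ n → 1 ≤ n → n < m + a k → RepAtMost k a (suc h) n
    below′ n _ n<m+aₖ with a k ≤? n
    ... | yes aₖ≤n =
      subst (RepAtMost k a (suc h)) (m∸n+n≡m aₖ≤n) (RepAtMost-addLast (IsN⇒RepAtMost {k} {a} isN
        (+-cancelʳ-< (a k) (n ∸ a k) m (subst (_< m + a k) (sym (m∸n+n≡m aₖ≤n)) n<m+aₖ))))
    ... | no aₖ≰n =
      RepAtMost-mono (subst (_≤ suc h) (sym (+-identityʳ _)) (≤-trans (≤-trans h₀≤h₁ h₁≤h) (n≤1+n h)))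
        (≤[1+i]aₖ⇒RepAtMost 0 n (subst (n ≤_) (sym (+-identityʳ (a k))) (<⇒≤ (≰⇒> aₖ≰n))))

  N₁ : ℕ
  N₁ = proj₁ (N-exists (h₁ k a))

  N-shift : ∀ d m → IsN k a (h₁ k a + d) m → m ≡ N₁ + d * a k
  N-shift zero m isN = trans (IsN-unique {k} {a} isN isN₁) (sym (+-identityʳ N₁))
    where
    isN₁ : IsN k a (h₁ k a + 0) N₁
    isN₁ = subst (λ h → IsN k a h N₁) (sym (+-identityʳ (h₁ k a))) (proj₂ (N-exists (h₁ k a)))
  N-shift (suc d) m isN with N-exists (h₁ k a + d)
  ... | m′ , isN′ = begin
    m                   ≡⟨ IsN-unique {k} {a} isN″ (N-suc (m≤m+n _ d) isN′) ⟩
    m′ + a k            ≡⟨ cong (_+ a k) (N-shift d m′ isN′) ⟩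
    N₁ + d * a k + a k  ≡⟨ regroup N₁ d (a k) ⟩
    N₁ + suc d * a k    ∎
    where
    open ≡-Reasoning
    isN″ : IsN k a (suc (h₁ k a + d)) m
    isN″ = subst (λ h → IsN k a h m) (+-suc (h₁ k a) d) isN
    regroup : ∀ n d c → n + d * c + c ≡ n + suc d * c
    regroup = solve-∀

  g : ℤ
  g = + (h₁ k a * a k) ℤ.- + N₁

  h*aₖ-N≡g : ∀ h → h₁ k a ≤ h → ∀ m → IsN k a h m → + (h * a k) ℤ.- + m ≡ g
  h*aₖ-N≡g h h₁≤h m isN = m+y≡n+x⇒x-m≡y-n {m} {N₁} {h * a k} {h₁ k a * a k} (begin
    m + h₁ k a * a k             ≡⟨ cong (_+ h₁ k a * a k) (N-shift d m isN′) ⟩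
    N₁ + d * a k + h₁ k a * a k  ≡⟨ regroup N₁ d (h₁ k a) (a k) ⟩
    N₁ + (h₁ k a + d) * a k      ≡⟨ cong (λ h → N₁ + h * a k) h₁+d≡h ⟩
    N₁ + h * a k                 ∎)
    where
    open ≡-Reasoning
    d = h ∸ h₁ k a
    h₁+d≡h : h₁ k a + d ≡ h
    h₁+d≡h = m+[n∸m]≡n h₁≤h
    isN′ : IsN k a (h₁ k a + d) m
    isN′ = subst (λ h → IsN k a h m) (sym h₁+d≡h) isN
    regroup : ∀ n d h c → n + d * c + h * c ≡ n + (h + d) * c
    regroup = solve-∀

  N≡h*aₖ-g : ∀ h → h₁ k a ≤ h → ∀ m → IsN k a h m → + m ≡ + (h * a k) ℤ.- g
  N≡h*aₖ-g h h₁≤h m isN = x-m≡g⇒m≡x-g (h*aₖ-N≡g h h₁≤h m isN)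

  -1≤g : -[1+ 0 ] ℤ.≤ g
  -1≤g = n≤1+m⇒-1≤m-n (h₁ k a * a k) N₁
    (IsN-≤ (proj₂ (N-exists (h₁ k a))) λ rep → <-irrefl refl (RepAtMost-≤ aᵢ≤aₖ rep))

  open Complement {K} {a} (λ i 1≤i i≤K → aᵢ≤aₖ i 1≤i (m≤n⇒m≤1+n i≤K))

  g-notRepFrob : ¬ RepFrob k (frobGens k a) g
  g-notRepFrob (y , Σb≡g) = ¬rep (complement⇒RepAtMost y Σb+N≡H*aₖ (m≤n+m _ (h₁ k a)))
    where
    H = h₁ k a + sumFrom1 y k
    N = proj₁ (N-exists H)
    isN = proj₂ (N-exists H)
    ¬rep = proj₁ (proj₂ isN)
    Σb+N≡H*aₖ = x-m≡c⇒c+m≡x (trans (h*aₖ-N≡g H (m≤m+n _ _) N isN) (sym Σb≡g))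

  >g⇒RepFrob : ∀ z → g ℤ.< z → RepFrob k (frobGens k a) z
  >g⇒RepFrob -[1+ w ] g<z = contradiction (ℤP.drop‿-<- (ℤP.≤-<-trans -1≤g g<z)) λ ()
  >g⇒RepFrob (+ z) g<z =
    proj₁ complement , cong +_ (+-cancelʳ-≡ n′ _ _ (trans (proj₂ complement) (sym (m+[n∸m]≡n z≤X))))
    where
    H = h₁ k a + suc z
    N = proj₁ (N-exists H)
    isN = proj₂ (N-exists H)
    X = H * a k
    X<z+N : X < z + N
    X<z+N = m-o<n⇒m<n+o X z N (subst (ℤ._< + z) (sym (h*aₖ-N≡g H (m≤m+n _ _) N isN)) g<z)
    z≤X : z ≤ X
    z≤X = ≤-trans (≤-trans (n≤1+n z) (m≤n+m (suc z) (h₁ k a)))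
                  (subst (_≤ X) (*-identityʳ H) (*-monoʳ-≤ H (a-pos k (s≤s z≤n) ≤-refl)))
    n′ = X ∸ z
    n′<N : n′ < N
    n′<N = +-cancelˡ-< z n′ N (subst (_< z + N) (sym (m+[n∸m]≡n z≤X)) X<z+N)
    complement = RepAtMost⇒complement (IsN⇒RepAtMost {k} {a} isN n′<N)

  isFrobenius : IsFrobenius k (frobGens k a) g
  isFrobenius = g-notRepFrob , >g⇒RepFrob

mainTheorem1 : (k : ℕ) (a : ℕ → ℕ) → Admissible k a →
    -- N_h is well defined for every h
    (∀ h → ∃ λ m → IsN k a h m)
    -- (a)
    × (∀ m → IsN k a (h₀ k a) m → a k < m)
    -- (b)
    × (∀ i m → IsN k a (h₀ k a + i) m → suc i * a k < m)
    -- (c)  N_h > (h+1) a_{k-1} - a_k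
    × (∀ h → h₁ k a ≤ h → ∀ m → IsN k a h m →
         (+ (suc h * a (k ∸ 1))) ℤ.- (+ a k) ℤ.< + m)
    -- (d)
    × (∀ h → h₁ k a ≤ h → ∀ m m′ → IsN k a h m → IsN k a (suc h) m′ → m′ ≡ m + a k)
    -- (e)
    × (Σ ℤ λ c → (-[1+ 0 ] ℤ.≤ c) ×
         (∀ h → h₁ k a ≤ h → ∀ m → IsN k a h m → (+ (h * a k)) ℤ.- (+ m) ≡ c))
    -- (f)
    × (∃ λ g → IsFrobenius k (frobGens k a) g ×
         (∀ h → h₁ k a ≤ h → ∀ m → IsN k a h m → + m ≡ (+ (h * a k)) ℤ.- g))
mainTheorem1 zero    a (() , _)
mainTheorem1 (suc K) a admissible =
  N-exists , N>aₖ , N>[1+i]aₖ ,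
  (λ h h₁≤h m isN → m<n+o⇒m-o<n _ m _ (<-≤-trans (N>[1+h]aₖ₋₁ h₁≤h isN) (m≤m+n m (a (suc K))))) ,
  (λ h h₁≤h m m′ isN isN′ → IsN-unique {suc K} {a} isN′ (N-suc h₁≤h isN)) ,
  (g , -1≤g , h*aₖ-N≡g) ,
  (g , isFrobenius , N≡h*aₖ-g)
  where open AdmissibleSequence admissible
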